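{- Let $G=(V,E)$ be a finite undirected graph with injective edge ranking $\pi$, and suppose the stored state $(P,k)$ represents the matching $\mathcal{M}=LFMM(G,\pi)$. If an edge $e=(u,v)\in E$ is deleted using the deletion procedure described below, then afterwards the stored state represents $LFMM(G-e,\pi)$.
   Context: $LFMM(G,\pi)$ (lexicographically first maximal matching) is the matching produced by the greedy procedure: all edges start white; repeatedly pick the white edge of minimum rank, add it to the matching, and color it and all white edges incident to it black. The matching is stored via, for each vertex $x$, $P(x)$ its partner ($-1$ if unmatched) and $k(x)$ the rank of its matching edge ($\infty$ if unmatched). $S$ is a min-priority queue of (vertex, priority) pairs. findNewPartners$(S)$: while $S$ is nonempty: remove the pair $(v',r)$ of lowest priority; scan neighbors $w$ of $v'$ with $r<\pi(v',w)<k(v')$ in increasing order of $\pi(v',w)$; for the first such $w$ with $\pi(v',w)<k(w)$: if $k(w)<\infty$, with $x=P(w)$ insert $(x,k(w))$ into $S$ and set $P(x)=-1,k(x)=\infty$; if $k(v')<\infty$, with $x=P(v')$ insert $(x,k(v'))$ into $S$ and set $P(x)=-1,k(x)=\infty$; set $P(v')=w,P(w)=v',k(v')=k(w)=\pi(v',w)$ and proceed to the next while-iteration. Deletion of $e=(u,v)$: remove $e$ from the graph, let $S$ be empty; if $P(v)=u$: insert $(u,\pi(e))$ and $(v,\pi(e))$ into $S$ and set $k(u)=k(v)=\infty$, $P(u)=P(v)=-1$. Finally call findNewPartners$(S)$. -}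

module Defs where

open import Data.Nat using (ℕ; zero; suc; _<_; _≤_; _<ᵇ_)
open import Data.Fin using (Fin; _≟_)
open import Data.Bool using (Bool; true; false; not; _∧_; _∨_; if_then_else_)
open import Data.Maybe using (Maybe; just; nothing)
open import Data.Product using (_×_; _,_; proj₁; proj₂)
open import Data.Sum using (_⊎_)
open import Data.Unit using (⊤)
open import Data.List using (List; []; _∷_; length)
open import Data.List.Membership.Propositional using (_∈_)
open import Data.List.Relation.Unary.All using (All)
open import Data.List.Relation.Unary.Any using (_─_)
open import Relation.Nullary using (¬_)
open import Relation.Nullary.Decidable using (⌊_⌋)
open import Relation.Binary.PropositionalEquality using (_≡_; _≢_)

-- Graphs: vertex set Fin n, edge set given by a list of (oriented
-- representatives of) undirected edges; ranking π on vertex pairs.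

Edge : ℕ → Set
Edge n = Fin n × Fin n

Rank : ℕ → Set
Rank n = Fin n → Fin n → ℕ

keep : {A : Set} → (A → Bool) → List A → List A
keep p [] = []
keep p (x ∷ xs) = if p x then x ∷ keep p xs else keep p xs

module _ {n : ℕ} where

  _=ᵇ_ : Fin n → Fin n → Bool
  a =ᵇ b = ⌊ a ≟ b ⌋

  hasV : Edge n → Fin n → Bool
  hasV (a , b) x = (a =ᵇ x) ∨ (b =ᵇ x)

  touches : Edge n → Edge n → Bool
  touches (a , b) e = hasV e a ∨ hasV e b

  sameEdge : Edge n → Edge n → Bool
  sameEdge (a , b) (c , d) = ((a =ᵇ c) ∧ (b =ᵇ d)) ∨ ((a =ᵇ d) ∧ (b =ᵇ c))

  Adj : List (Edge n) → Fin n → Fin n → Set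
  Adj E a b = (a , b) ∈ E ⊎ (b , a) ∈ E

  Loopless : List (Edge n) → Set
  Loopless E = ∀ a b → (a , b) ∈ E → a ≢ b

  SymRank : Rank n → Set
  SymRank π = ∀ a b → π a b ≡ π b a

  InjRank : List (Edge n) → Rank n → Set
  InjRank E π = ∀ a b c d → (a , b) ∈ E → (c , d) ∈ E → π a b ≡ π c d →
                (a ≡ c × b ≡ d) ⊎ (a ≡ d × b ≡ c)

  deleteEdge : List (Edge n) → Fin n → Fin n → List (Edge n)
  deleteEdge E u v = keep (λ e → not (sameEdge (u , v) e)) E

  -- Fuel = number of edges (each round blackens
  -- at least the chosen edge).

  rk : Rank n → Edge n → ℕ
  rk π (a , b) = π a b

  minEdge : Rank n → Edge n → List (Edge n) → Edge n
  minEdge π m [] = m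
  minEdge π m (e ∷ es) = minEdge π (if rk π e <ᵇ rk π m then e else m) es

  greedy : Rank n → ℕ → List (Edge n) → List (Edge n)
  greedy π zero _ = []
  greedy π (suc f) [] = []
  greedy π (suc f) (e ∷ es) =
    minEdge π e es ∷ greedy π f (keep (λ e' → not (touches (minEdge π e es) e')) (e ∷ es))

  LFMM : Rank n → List (Edge n) → List (Edge n)
  LFMM π E = greedy π (length E) E

  -- partner / rank of matching edge of x in matching M (nothing = -1 / ∞)
  partnerIn : List (Edge n) → Fin n → Maybe (Fin n)
  partnerIn [] x = nothing
  partnerIn ((a , b) ∷ M) x =
    if a =ᵇ x then just b else (if b =ᵇ x then just a else partnerIn M x)

  matchRank : Rank n → List (Edge n) → Fin n → Maybe ℕ
  matchRank π [] x = nothing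
  matchRank π ((a , b) ∷ M) x =
    if hasV (a , b) x then just (π a b) else matchRank π M x

  Represents : List (Edge n) → Rank n → (Fin n → Maybe (Fin n)) → (Fin n → Maybe ℕ) → Set
  Represents E π P k = ∀ x → (P x ≡ partnerIn (LFMM π E) x) × (k x ≡ matchRank π (LFMM π E) x)

  -- The dynamic algorithm.  k values in ℕ∞ are Maybe ℕ (nothing = ∞).

  _<∞_ : ℕ → Maybe ℕ → Set
  r <∞ just m = r < m
  r <∞ nothing = ⊤

  record State : Set where
    constructor ⟨_,_,_⟩
    field
      P : Fin n → Maybe (Fin n)
      k : Fin n → Maybe ℕ
      S : List (Fin n × ℕ)      -- priority queue as a multiset of (vertex, priority)
  open State public

  upd : {A : Set} → (Fin n → A) → Fin n → A → Fin n → A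
  upd f x a y = if y =ᵇ x then a else f y

  evict : State → Fin n → State
  evict st y with k st y | P st y
  ... | just ky | just x = ⟨ upd (P st) x nothing , upd (k st) x nothing , (x , ky) ∷ S st ⟩
  ... | _ | _ = st

  matchUp : Rank n → State → Fin n → Fin n → State
  matchUp π st v' w =
    ⟨ upd (upd (P st) v' (just w)) w (just v')
    , upd (upd (k st) v' (just (π v' w))) w (just (π v' w))
    , S st ⟩

  Cand : List (Edge n) → Rank n → State → Fin n → ℕ → Fin n → Set
  Cand E π st v' r w = Adj E v' w × r < π v' w × π v' w <∞ k st v' × π v' w <∞ k st w

  First : List (Edge n) → Rank n → State → Fin n → ℕ → Fin n → Set
  First E π st v' r w = Cand E π st v' r w × (∀ w' → Cand E π st v' r w' → π v' w ≤ π v' w')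

  -- one iteration of the while loop of findNewPartners (on graph E).
  -- Any pair of lowest priority may be removed (tie-breaking arbitrary).
  data Step (E : List (Edge n)) (π : Rank n) : State → State → Set where
    noPartner : ∀ {st v' r} (p : (v' , r) ∈ S st) → All (λ q → r ≤ proj₂ q) (S st) →
                (∀ w → ¬ Cand E π st v' r w) →
                Step E π st ⟨ P st , k st , S st ─ p ⟩
    newPartner : ∀ {st v' r w} (p : (v' , r) ∈ S st) → All (λ q → r ≤ proj₂ q) (S st) →
                 First E π st v' r w →
                 Step E π st (matchUp π (evict (evict ⟨ P st , k st , S st ─ p ⟩ w) v') v' w)

  -- deletion of e = (u, v): state just before calling findNewPartners
  initDelete : Rank n → Fin n → Fin n → (Fin n → Maybe (Fin n)) → (Fin n → Maybe ℕ) → State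
  initDelete π u v P₀ k₀ with P₀ v
  ... | just x = if x =ᵇ u
                 then ⟨ upd (upd P₀ u nothing) v nothing , upd (upd k₀ u nothing) v nothing
                      , (u , π u v) ∷ (v , π u v) ∷ [] ⟩
                 else ⟨ P₀ , k₀ , [] ⟩
  ... | nothing = ⟨ P₀ , k₀ , [] ⟩

module Submission where

-- LFMM(G, π) is the unique matching of G dominating every edge, i.e. giving every edge an
-- endpoint matched along an edge of no larger rank: for two such matchings, an edge of rank ρ
-- in one is in the other, by strong induction on ρ using injectivity of π.  So it suffices
-- that findNewPartners keeps (P, k) a matching of G − e in which every edge is dominated or has
-- an endpoint queued with a priority below its rank.  Deleting e = uv from LFMM(G, π) breaks
-- domination only at edges through u or v, which the queue entries (u, π e), (v, π e) cover.
-- A step preserves this because the scan of the removed vertex v' stops at its lightest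
-- candidate w: edges v'b lighter than v'w are dominated, and vertices evicted from their
-- partners are queued with the rank of their lost edge.  When the queue is empty, (P, k) is a
-- dominating matching of G − e, hence LFMM(G − e, π).

open import Defs
open import Data.Nat using (ℕ; zero; suc; _<_; _≤_; _<ᵇ_; _<?_; _≤?_; _+_; _*_; _^_; _∸_; z≤n; s≤s)
open import Data.Nat.Properties hiding (_≟_)
open import Data.Nat.Induction using (<-rec)
open import Algebra.Properties.CommutativeSemigroup +-commutativeSemigroup using (x∙yz≈y∙xz)
open import Data.Fin using (Fin; _≟_)
open import Data.Bool using (Bool; true; false; not; _∧_; _∨_)
open import Data.Bool.Properties using (not-injective; not-¬; ∨-zeroʳ)
open import Data.Maybe using (Maybe; just; nothing)
import Data.Maybe as Maybe
open import Data.Maybe.Properties using (just-injective)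
import Data.Maybe.Properties as Maybe
open import Data.Maybe.Relation.Unary.Any using (Any; just)
open import Data.Product using (_×_; _,_; proj₁; proj₂; ∃)
import Data.Product as Product
import Data.Product.Properties as Product
open import Data.Sum using (_⊎_; inj₁; inj₂)
import Data.Sum as Sum
open import Data.List using (List; []; _∷_; length; _++_; allFin)
import Data.List as List
open import Data.List.Extrema.Nat using (max; xs≤max)
open import Data.List.Membership.Propositional using (_∈_)
open import Data.List.Membership.Propositional.Properties using (∈-++⁺ˡ; ∈-++⁺ʳ; ∈-allFin)
open import Data.List.Properties using (++-assoc; length-++)
open import Data.List.Relation.Unary.Any using (here; there; _─_)
open import Data.List.Relation.Unary.All as All using (All)
import Data.List.Relation.Unary.All.Properties as All
open import Data.List.Relation.Unary.AllPairs using (AllPairs; []; _∷_)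
open import Function using (_∘_; flip; case_of_)
open import Data.Unit using (tt)
open import Induction.WellFounded using (Acc; acc)
open import Relation.Binary.Construct.Closure.ReflexiveTransitive using (Star; ε; _◅_)
open import Relation.Nullary using (¬_; Dec; yes; no; contradiction)
open import Relation.Nullary.Decidable using (_×-dec_; _⊎-dec_)
open import Relation.Nullary.Reflects using (ofʸ; ofⁿ)
open import Relation.Binary.PropositionalEquality
open import Relation.Unary using (Decidable)

keep-∈⁻ : ∀ {A : Set} (p : A → Bool) {x} xs → x ∈ keep p xs → x ∈ xs × p x ≡ true
keep-∈⁻ p (y ∷ ys) x∈ with p y in py
keep-∈⁻ p (y ∷ ys) (here refl) | true = here refl , py
keep-∈⁻ p (y ∷ ys) (there x∈)  | true = Product.map₁ there (keep-∈⁻ p ys x∈)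
keep-∈⁻ p (y ∷ ys) x∈          | false = Product.map₁ there (keep-∈⁻ p ys x∈)

keep-∈⁺ : ∀ {A : Set} (p : A → Bool) {x} xs → x ∈ xs → p x ≡ true → x ∈ keep p xs
keep-∈⁺ p (y ∷ ys) (here refl) px rewrite px = here refl
keep-∈⁺ p (y ∷ ys) (there x∈) px with p y
... | true  = there (keep-∈⁺ p ys x∈ px)
... | false = keep-∈⁺ p ys x∈ px

length-keep≤ : ∀ {A : Set} (p : A → Bool) xs → length (keep p xs) ≤ length xs
length-keep≤ p [] = z≤n
length-keep≤ p (y ∷ ys) with p y
... | true  = s≤s (length-keep≤ p ys)
... | false = m≤n⇒m≤1+n (length-keep≤ p ys)

length-keep< : ∀ {A : Set} (p : A → Bool) {x} xs → x ∈ xs → p x ≡ false →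
               length (keep p xs) < length xs
length-keep< p (y ∷ ys) (here refl) px rewrite px = s≤s (length-keep≤ p ys)
length-keep< p (y ∷ ys) (there x∈) px with p y
... | true  = s≤s (length-keep< p ys x∈ px)
... | false = m≤n⇒m≤1+n (length-keep< p ys x∈ px)

∈⇒≡⊎∈-─ : ∀ {A : Set} {x y : A} {xs} (y∈ : y ∈ xs) → x ∈ xs → x ≡ y ⊎ x ∈ (xs ─ y∈)
∈⇒≡⊎∈-─ (here refl) (here x≡y) = inj₁ x≡y
∈⇒≡⊎∈-─ (here refl) (there x∈) = inj₂ x∈
∈⇒≡⊎∈-─ (there y∈)  (here x≡z) = inj₂ (here x≡z)
∈⇒≡⊎∈-─ (there y∈)  (there x∈) = Sum.map₂ there (∈⇒≡⊎∈-─ y∈ x∈)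

min-satisfying : ∀ {A : Set} {Q : A → Set} → Decidable Q → (f : A → ℕ) → (xs : List A) →
                 (∀ {x} → x ∈ xs → ¬ Q x) ⊎
                 ∃ λ x → x ∈ xs × Q x × (∀ {y} → y ∈ xs → Q y → f x ≤ f y)
min-satisfying Q? f [] = inj₁ λ ()
min-satisfying Q? f (x ∷ xs) with Q? x | min-satisfying Q? f xs
... | no ¬Qx | inj₁ none = inj₁ λ { (here refl) → ¬Qx ; (there y∈) → none y∈ }
... | no ¬Qx | inj₂ (m , m∈ , Qm , min) =
      inj₂ (m , there m∈ , Qm , λ { (here refl) Qy → contradiction Qy ¬Qx ; (there y∈) → min y∈ })
... | yes Qx | inj₁ none =
      inj₂ (x , here refl , Qx , λ { (here refl) _ → ≤-refl ; (there y∈) Qy → contradiction Qy (none y∈) })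
... | yes Qx | inj₂ (m , m∈ , Qm , min) with f x ≤? f m
...   | yes fx≤fm =
        inj₂ (x , here refl , Qx , λ { (here refl) _ → ≤-refl ; (there y∈) Qy → ≤-trans fx≤fm (min y∈ Qy) })
...   | no fx≰fm = inj₂ (m , there m∈ , Qm , λ { (here refl) _ → ≰⇒≥ fx≰fm ; (there y∈) → min y∈ })

module _ {n : ℕ} where

  upd-same : ∀ {A : Set} (f : Fin n → A) x a → upd f x a x ≡ a
  upd-same f x a with x ≟ x
  ... | yes _ = refl
  ... | no x≢x = contradiction refl x≢x

  upd-other : ∀ {A : Set} (f : Fin n → A) {x y} a → y ≢ x → upd f x a y ≡ f y
  upd-other f {x} {y} a y≢x with y ≟ x
  ... | yes y≡x = contradiction y≡x y≢x
  ... | no _ = refl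

  touches-refl : ∀ (g : Edge n) → touches g g ≡ true
  touches-refl (a , b) with a ≟ a
  ... | yes _ = refl
  ... | no a≢a = contradiction refl a≢a

  touches⇒shared : ∀ {a b c d : Fin n} → touches (c , d) (a , b) ≡ true →
                   ∃ λ x → (x ≡ c ⊎ x ≡ d) × (x ≡ a ⊎ x ≡ b)
  touches⇒shared {a} {b} {c} {d} t with a ≟ c | b ≟ c | a ≟ d | b ≟ d
  ... | yes a≡c | _ | _ | _ = a , inj₁ a≡c , inj₁ refl
  ... | no _ | yes b≡c | _ | _ = b , inj₁ b≡c , inj₂ refl
  ... | no _ | no _ | yes a≡d | _ = a , inj₂ a≡d , inj₁ refl
  ... | no _ | no _ | no _ | yes b≡d = b , inj₂ b≡d , inj₂ refl

  disjoint⇒≢ : ∀ {a b c d : Fin n} → touches (c , d) (a , b) ≡ false →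
               (c ≢ a × d ≢ a) × (c ≢ b × d ≢ b)
  disjoint⇒≢ {a = a} {b} {c} {d} t with a ≟ c | b ≟ c | a ≟ d | b ≟ d
  disjoint⇒≢ () | yes _ | _ | _ | _
  disjoint⇒≢ () | no _ | yes _ | _ | _
  disjoint⇒≢ () | no _ | no _ | yes _ | _
  disjoint⇒≢ () | no _ | no _ | no _ | yes _
  ... | no a≢c | no b≢c | no a≢d | no b≢d = (≢-sym a≢c , ≢-sym a≢d) , (≢-sym b≢c , ≢-sym b≢d)

  =ᵇ∧=ᵇ⇒≡ : ∀ {a b c d : Fin n} → (a =ᵇ b) ∧ (c =ᵇ d) ≡ true → a ≡ b × c ≡ d
  =ᵇ∧=ᵇ⇒≡ {a} {b} {c} {d} eq with a ≟ b | c ≟ d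
  ... | yes a≡b | yes c≡d = a≡b , c≡d
  =ᵇ∧=ᵇ⇒≡ () | yes _ | no _
  =ᵇ∧=ᵇ⇒≡ () | no _ | _

  Adj-sym : ∀ {G : List (Edge n)} {a b} → Adj G a b → Adj G b a
  Adj-sym = Sum.swap

  Adj-irrefl : ∀ {G : List (Edge n)} → Loopless G → ∀ {a b} → Adj G a b → a ≢ b
  Adj-irrefl loopless (inj₁ ab∈) = loopless _ _ ab∈
  Adj-irrefl loopless (inj₂ ba∈) = loopless _ _ ba∈ ∘ sym

module Greedy {n : ℕ} (π : Rank n) where

  minEdge-∈ : ∀ m es → minEdge π m es ∈ m ∷ es
  minEdge-∈ m [] = here refl
  minEdge-∈ m (e ∷ es) with rk π e <ᵇ rk π m
  ... | true = there (minEdge-∈ e es)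
  ... | false with minEdge-∈ m es
  ...   | here eq = here eq
  ...   | there g∈ = there (there g∈)

  minEdge-≤ : ∀ m es {g} → g ∈ m ∷ es → rk π (minEdge π m es) ≤ rk π g
  minEdge-≤ m [] (here refl) = ≤-refl
  minEdge-≤ m (e ∷ es) g∈ with rk π e <ᵇ rk π m | <ᵇ-reflects-< (rk π e) (rk π m)
  minEdge-≤ m (e ∷ es) (here refl) | true | ofʸ e<m = ≤-trans (minEdge-≤ e es (here refl)) (<⇒≤ e<m)
  minEdge-≤ m (e ∷ es) (there g∈)  | true | ofʸ _ = minEdge-≤ e es g∈
  minEdge-≤ m (e ∷ es) (here refl) | false | ofⁿ _ = minEdge-≤ m es (here refl)
  minEdge-≤ m (e ∷ es) (there (here refl)) | false | ofⁿ e≮m =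
    ≤-trans (minEdge-≤ m es (here refl)) (≮⇒≥ e≮m)
  minEdge-≤ m (e ∷ es) (there (there g∈)) | false | ofⁿ _ = minEdge-≤ m es (there g∈)

  Disjoint : Edge n → Edge n → Set
  Disjoint g h = touches g h ≡ false

  record GreedyOutput (W L : List (Edge n)) : Set where
    field
      chosen⊆input : ∀ {g} → g ∈ L → g ∈ W
      chosen-disjoint : AllPairs Disjoint L
      input-dominated : ∀ {e} → e ∈ W → ∃ λ g → g ∈ L × touches g e ≡ true × rk π g ≤ rk π e

  greedy-output : ∀ fuel W → length W ≤ fuel → GreedyOutput W (greedy π fuel W)
  greedy-output zero [] _ = record { chosen⊆input = λ () ; chosen-disjoint = [] ; input-dominated = λ () }
  greedy-output (suc fuel) [] _ = record { chosen⊆input = λ () ; chosen-disjoint = [] ; input-dominated = λ () }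
  greedy-output (suc fuel) (e ∷ es) (s≤s len≤) = record
    { chosen⊆input = λ { (here refl) → minEdge-∈ e es ; (there g∈) → proj₁ (kept g∈) }
    ; chosen-disjoint = All.tabulate (λ g∈ → not-injective {y = false} (proj₂ (kept g∈))) ∷ chosen-disjoint
    ; input-dominated = dominated }
    where
    W = e ∷ es
    m = minEdge π e es
    white : Edge n → Bool
    white e' = not (touches m e')
    open GreedyOutput (greedy-output fuel (keep white W)
      (≤-trans (≤-pred (length-keep< white W (minEdge-∈ e es) (cong not (touches-refl m)))) len≤))
    kept : ∀ {g} → g ∈ greedy π fuel (keep white W) → g ∈ W × white g ≡ true
    kept = keep-∈⁻ white W ∘ chosen⊆input
    dominated : ∀ {e'} → e' ∈ W →
                ∃ λ g → g ∈ m ∷ greedy π fuel (keep white W) × touches g e' ≡ true × rk π g ≤ rk π e'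
    dominated {e'} e'∈ with touches m e' in t
    ... | true = m , here refl , t , minEdge-≤ e es e'∈
    ... | false = Product.map₂ (Product.map₁ there) (input-dominated (keep-∈⁺ white W e'∈ (cong not t)))

  lfmm-output : ∀ G → GreedyOutput G (LFMM π G)
  lfmm-output G = greedy-output (length G) G ≤-refl

module Matchings {n : ℕ} (π : Rank n) (π-sym : SymRank π) where
  open Greedy π

  record Matching (G : List (Edge n)) (P : Fin n → Maybe (Fin n)) (k : Fin n → Maybe ℕ) : Set where
    field
      partner-sym : ∀ {x y} → P x ≡ just y → P y ≡ just x
      partner-adj : ∀ {x y} → P x ≡ just y → Adj G x y
      rank : ∀ x → k x ≡ Maybe.map (π x) (P x)

    rank-matched : ∀ {x y} → P x ≡ just y → k x ≡ just (π x y)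
    rank-matched {x} Px = trans (rank x) (cong (Maybe.map (π x)) Px)

  Dominated : (Fin n → Maybe ℕ) → Fin n → Fin n → Set
  Dominated k a b = Any (_≤ π a b) (k a) ⊎ Any (_≤ π a b) (k b)

  Dominating : List (Edge n) → (Fin n → Maybe ℕ) → Set
  Dominating G k = ∀ {a b} → Adj G a b → Dominated k a b

  Dominated-sym : ∀ {k a b} → Dominated k b a → Dominated k a b
  Dominated-sym {a = a} {b} = Sum.swap ∘ Sum.map (subst-rank) (subst-rank)
    where
    subst-rank : ∀ {m} → Any (_≤ π b a) m → Any (_≤ π a b) m
    subst-rank = subst (λ r → Any (_≤ r) _) (π-sym b a)

  partnerIn-head-fst : ∀ {M : List (Edge n)} {a b} → partnerIn ((a , b) ∷ M) a ≡ just b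
  partnerIn-head-fst {a = a} with a ≟ a
  ... | yes _ = refl
  ... | no a≢a = contradiction refl a≢a

  partnerIn-head-snd : ∀ {M : List (Edge n)} {a b} → a ≢ b → partnerIn ((a , b) ∷ M) b ≡ just a
  partnerIn-head-snd {a = a} {b} a≢b with a ≟ b | b ≟ b
  ... | yes a≡b | _ = contradiction a≡b a≢b
  ... | no _ | yes _ = refl
  ... | no _ | no b≢b = contradiction refl b≢b

  partnerIn-skip : ∀ {M : List (Edge n)} {c d x} → c ≢ x → d ≢ x → partnerIn ((c , d) ∷ M) x ≡ partnerIn M x
  partnerIn-skip {c = c} {d} {x} c≢x d≢x with c ≟ x | d ≟ x
  ... | yes c≡x | _ = contradiction c≡x c≢x
  ... | no _ | yes d≡x = contradiction d≡x d≢x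
  ... | no _ | no _ = refl

  partnerIn-∈ : ∀ {L : List (Edge n)} {a b} → AllPairs Disjoint L → (a , b) ∈ L → a ≢ b →
                partnerIn L a ≡ just b × partnerIn L b ≡ just a
  partnerIn-∈ {_ ∷ L} {a} _ (here refl) a≢b = partnerIn-head-fst {L} {a} , partnerIn-head-snd {L} a≢b
  partnerIn-∈ {(c , d) ∷ L} {a} {b} (disj ∷ disjs) (there ab∈) a≢b =
    let ((c≢a , d≢a) , (c≢b , d≢b)) = disjoint⇒≢ {a = a} {b} {c} {d} (All.lookup disj ab∈)
        (Pa , Pb) = partnerIn-∈ disjs ab∈ a≢b
    in trans (partnerIn-skip {L} c≢a d≢a) Pa , trans (partnerIn-skip {L} c≢b d≢b) Pb

  partnerIn-sound : ∀ (L : List (Edge n)) {x y} → partnerIn L x ≡ just y → (x , y) ∈ L ⊎ (y , x) ∈ L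
  partnerIn-sound ((c , d) ∷ M) {x} Px with c ≟ x | d ≟ x
  partnerIn-sound ((c , d) ∷ M) refl | yes refl | _ = inj₁ (here refl)
  partnerIn-sound ((c , d) ∷ M) refl | no _ | yes refl = inj₂ (here refl)
  ... | no _ | no _ = Sum.map there there (partnerIn-sound M Px)

  matchRank≡rank-of-partnerIn : ∀ (L : List (Edge n)) x → matchRank π L x ≡ Maybe.map (π x) (partnerIn L x)
  matchRank≡rank-of-partnerIn [] x = refl
  matchRank≡rank-of-partnerIn ((c , d) ∷ M) x with c ≟ x | d ≟ x
  ... | yes refl | _ = refl
  ... | no _ | yes refl = cong just (π-sym c d)
  ... | no _ | no _ = matchRank≡rank-of-partnerIn M x

  module _ (G : List (Edge n)) (loopless : Loopless G) where
    open GreedyOutput (lfmm-output G)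

    lfmm-matching : Matching G (partnerIn (LFMM π G)) (matchRank π (LFMM π G))
    lfmm-matching = record
      { partner-sym = case-sound ∘ partnerIn-sound (LFMM π G)
      ; partner-adj = Sum.map chosen⊆input chosen⊆input ∘ partnerIn-sound (LFMM π G)
      ; rank = matchRank≡rank-of-partnerIn (LFMM π G) }
      where
      case-sound : ∀ {x y} → (x , y) ∈ LFMM π G ⊎ (y , x) ∈ LFMM π G → partnerIn (LFMM π G) y ≡ just x
      case-sound (inj₁ xy∈) = proj₂ (partnerIn-∈ chosen-disjoint xy∈ (loopless _ _ (chosen⊆input xy∈)))
      case-sound (inj₂ yx∈) = proj₁ (partnerIn-∈ chosen-disjoint yx∈ (loopless _ _ (chosen⊆input yx∈)))

    endpoint-rank : ∀ {c d x} → (c , d) ∈ LFMM π G → x ≡ c ⊎ x ≡ d →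
                    matchRank π (LFMM π G) x ≡ just (π c d)
    endpoint-rank {c} {d} cd∈ x∈cd with partnerIn-∈ chosen-disjoint cd∈ (loopless c d (chosen⊆input cd∈))
    endpoint-rank {c} {d} cd∈ (inj₁ refl) | Pc , _ =
      trans (matchRank≡rank-of-partnerIn (LFMM π G) c) (cong (Maybe.map (π c)) Pc)
    endpoint-rank {c} {d} cd∈ (inj₂ refl) | _ , Pd =
      trans (matchRank≡rank-of-partnerIn (LFMM π G) d) (trans (cong (Maybe.map (π d)) Pd) (cong just (π-sym d c)))

    lfmm-dominating : Dominating G (matchRank π (LFMM π G))
    lfmm-dominating (inj₁ ab∈) with input-dominated ab∈
    ... | (c , d) , cd∈ , t , cd≤ab with touches⇒shared t
    ...   | x , x∈cd , inj₁ refl = inj₁ (subst (Any _) (sym (endpoint-rank cd∈ x∈cd)) (just cd≤ab))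
    ...   | x , x∈cd , inj₂ refl = inj₂ (subst (Any _) (sym (endpoint-rank cd∈ x∈cd)) (just cd≤ab))
    lfmm-dominating (inj₂ ba∈) = Dominated-sym (lfmm-dominating (inj₁ ba∈))

  module _ {G : List (Edge n)} (loopless : Loopless G) (injective : InjRank G π) where

    Adj-rank-injective : ∀ {a b c d} → Adj G a b → Adj G c d → π a b ≡ π c d →
                         (a ≡ c × b ≡ d) ⊎ (a ≡ d × b ≡ c)
    Adj-rank-injective {a} {b} {c} {d} (inj₁ ab∈) (inj₁ cd∈) eq = injective a b c d ab∈ cd∈ eq
    Adj-rank-injective {a} {b} {c} {d} (inj₁ ab∈) (inj₂ dc∈) eq =
      Sum.swap (injective a b d c ab∈ dc∈ (trans eq (π-sym c d)))
    Adj-rank-injective {a} {b} {c} {d} (inj₂ ba∈) (inj₁ cd∈) eq =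
      Sum.map Product.swap Product.swap (Sum.swap (injective b a c d ba∈ cd∈ (trans (π-sym b a) eq)))
    Adj-rank-injective {a} {b} {c} {d} (inj₂ ba∈) (inj₂ dc∈) eq =
      Sum.map Product.swap Product.swap (injective b a d c ba∈ dc∈ (trans (π-sym b a) (trans eq (π-sym c d))))

    AgreeAt : (P₁ P₂ : Fin n → Maybe (Fin n)) → ℕ → Set
    AgreeAt P₁ P₂ ρ = ∀ {x y} → π x y ≡ ρ → P₁ x ≡ just y → P₂ x ≡ just y

    -- The P₂-edge xz has rank ≤ ρ: below ρ it is a P₁-edge by induction, so z = y;
    -- at ρ it is xy by injectivity of the ranking.
    agree-at-dominated-endpoint :
      ∀ {P₁ k₁ P₂ k₂ ρ x y} → Matching G P₁ k₁ → Matching G P₂ k₂ →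
      (∀ {ρ'} → ρ' < ρ → AgreeAt P₂ P₁ ρ') →
      π x y ≡ ρ → P₁ x ≡ just y → Any (_≤ ρ) (k₂ x) → P₂ x ≡ just y
    agree-at-dominated-endpoint {P₂ = P₂} {ρ = ρ} {x} M₁ M₂ below πxy≡ρ P₁x k₂x≤ρ
      with P₂ x in P₂x | subst (Any (_≤ ρ)) (Matching.rank M₂ x) k₂x≤ρ
    ... | just z | just πxz≤ρ with m≤n⇒m<n∨m≡n πxz≤ρ
    ...   | inj₁ πxz<ρ = trans (sym (below πxz<ρ refl P₂x)) P₁x
    ...   | inj₂ πxz≡ρ
      with Adj-rank-injective (Matching.partner-adj M₂ P₂x) (Matching.partner-adj M₁ P₁x)
                              (trans πxz≡ρ (sym πxy≡ρ))
    ...     | inj₁ (_ , z≡y) = cong just z≡y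
    ...     | inj₂ (x≡y , _) = contradiction x≡y (Adj-irrefl loopless (Matching.partner-adj M₁ P₁x))

    agree-step : ∀ {P₁ k₁ P₂ k₂ ρ} → Matching G P₁ k₁ → Matching G P₂ k₂ → Dominating G k₂ →
                 (∀ {ρ'} → ρ' < ρ → AgreeAt P₂ P₁ ρ') → AgreeAt P₁ P₂ ρ
    agree-step M₁ M₂ D₂ below {x} {y} πxy≡ρ P₁x with D₂ (Matching.partner-adj M₁ P₁x)
    ... | inj₁ k₂x≤ =
          agree-at-dominated-endpoint M₁ M₂ below πxy≡ρ P₁x (subst (λ r → Any (_≤ r) _) πxy≡ρ k₂x≤)
    ... | inj₂ k₂y≤ = Matching.partner-sym M₂
          (agree-at-dominated-endpoint M₁ M₂ below (trans (π-sym y x) πxy≡ρ) (Matching.partner-sym M₁ P₁x)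
            (subst (λ r → Any (_≤ r) _) πxy≡ρ k₂y≤))

    agree : ∀ {P₁ k₁ P₂ k₂} → Matching G P₁ k₁ → Dominating G k₁ →
            Matching G P₂ k₂ → Dominating G k₂ → ∀ ρ → AgreeAt P₁ P₂ ρ × AgreeAt P₂ P₁ ρ
    agree {P₁ = P₁} {P₂ = P₂} M₁ D₁ M₂ D₂ =
      <-rec (λ ρ → AgreeAt P₁ P₂ ρ × AgreeAt P₂ P₁ ρ) λ ρ below →
      agree-step M₁ M₂ D₂ (λ lt → proj₂ (below lt)) , agree-step M₂ M₁ D₁ (λ lt → proj₁ (below lt))

    dominating-matching-unique : ∀ {P₁ k₁ P₂ k₂} → Matching G P₁ k₁ → Dominating G k₁ →
                                 Matching G P₂ k₂ → Dominating G k₂ → ∀ x → P₁ x ≡ P₂ x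
    dominating-matching-unique {P₁ = P₁} {P₂ = P₂} M₁ D₁ M₂ D₂ x with P₁ x in P₁x
    ... | just y = sym (proj₁ (agree M₁ D₁ M₂ D₂ (π x y)) refl P₁x)
    ... | nothing with P₂ x in P₂x
    ...   | nothing = refl
    ...   | just y with () ← trans (sym P₁x) (proj₂ (agree M₁ D₁ M₂ D₂ (π x y)) refl P₂x)

    matching⇒represents : ∀ {P k} → Matching G P k → Dominating G k → Represents G π P k
    matching⇒represents {P} {k} M D x = P≡ , (begin
      k x                                       ≡⟨ Matching.rank M x ⟩
      Maybe.map (π x) (P x)                     ≡⟨ cong (Maybe.map (π x)) P≡ ⟩
      Maybe.map (π x) (partnerIn (LFMM π G) x)  ≡⟨ sym (matchRank≡rank-of-partnerIn (LFMM π G) x) ⟩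
      matchRank π (LFMM π G) x                  ∎)
      where
      open ≡-Reasoning
      P≡ : P x ≡ partnerIn (LFMM π G) x
      P≡ = dominating-matching-unique M D (lfmm-matching G loopless) (lfmm-dominating G loopless) x

  module _ {G : List (Edge n)} (loopless : Loopless G) {P k} (rep : Represents G π P k) where

    represents⇒matching : Matching G P k
    represents⇒matching = record
      { partner-sym = λ {x} {y} Px → trans (P≡ y) (partner-sym (trans (sym (P≡ x)) Px))
      ; partner-adj = λ {x} Px → partner-adj (trans (sym (P≡ x)) Px)
      ; rank = λ x → trans (proj₂ (rep x)) (trans (rank x) (cong (Maybe.map (π x)) (sym (P≡ x)))) }
      where
      open Matching (lfmm-matching G loopless)
      P≡ : ∀ x → P x ≡ partnerIn (LFMM π G) x
      P≡ = proj₁ ∘ rep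

    represents⇒dominating : Dominating G k
    represents⇒dominating adj = Sum.map (transfer _) (transfer _) (lfmm-dominating G loopless adj)
      where
      transfer : ∀ x {r} → Any (_≤ r) (matchRank π (LFMM π G) x) → Any (_≤ r) (k x)
      transfer x = subst (Any _) (sym (proj₂ (rep x)))

module Deletion {n : ℕ} (E : List (Edge n)) (π : Rank n)
                (loopless : Loopless E) (π-sym : SymRank π) (injective : InjRank E π)
                (u v : Fin n) (uv∈E : Adj E u v) where
  open Matchings π π-sym

  G : List (Edge n)
  G = deleteEdge E u v

  IsUV : Fin n → Fin n → Set
  IsUV a b = (u ≡ a × v ≡ b) ⊎ (u ≡ b × v ≡ a)

  sameEdge⇒IsUV : ∀ {a b} → sameEdge (u , v) (a , b) ≡ true → IsUV a b
  sameEdge⇒IsUV {a} {b} same with (u =ᵇ a) ∧ (v =ᵇ b) in uv≡ab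
  ... | true = inj₁ (=ᵇ∧=ᵇ⇒≡ uv≡ab)
  ... | false = inj₂ (=ᵇ∧=ᵇ⇒≡ same)

  IsUV⇒sameEdge : ∀ {a b} → IsUV a b → sameEdge (u , v) (a , b) ≡ true
  IsUV⇒sameEdge (inj₁ (refl , refl)) with u ≟ u | v ≟ v
  ... | yes _ | yes _ = refl
  ... | no u≢u | _ = contradiction refl u≢u
  ... | yes _ | no v≢v = contradiction refl v≢v
  IsUV⇒sameEdge (inj₂ (refl , refl)) with u ≟ u | v ≟ v
  ... | yes _ | yes _ = ∨-zeroʳ _
  ... | no u≢u | _ = contradiction refl u≢u
  ... | yes _ | no v≢v = contradiction refl v≢v

  IsUV-sym : ∀ {a b} → IsUV a b → IsUV b a
  IsUV-sym = Sum.swap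

  ∈G⇒∈E×¬IsUV : ∀ {a b} → (a , b) ∈ G → (a , b) ∈ E × ¬ IsUV a b
  ∈G⇒∈E×¬IsUV ab∈ =
    let (ab∈E , kept) = keep-∈⁻ _ E ab∈ in ab∈E , λ uv → not-¬ (sym (IsUV⇒sameEdge uv)) (sym kept)

  ∈E×¬IsUV⇒∈G : ∀ {a b} → (a , b) ∈ E → ¬ IsUV a b → (a , b) ∈ G
  ∈E×¬IsUV⇒∈G {a} {b} ab∈ ¬uv = keep-∈⁺ _ E ab∈ kept
    where
    kept : not (sameEdge (u , v) (a , b)) ≡ true
    kept with sameEdge (u , v) (a , b) in same
    ... | true = contradiction (sameEdge⇒IsUV same) ¬uv
    ... | false = refl

  AdjG⇒AdjE : ∀ {a b} → Adj G a b → Adj E a b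
  AdjG⇒AdjE = Sum.map (proj₁ ∘ ∈G⇒∈E×¬IsUV) (proj₁ ∘ ∈G⇒∈E×¬IsUV)

  AdjG⇒¬IsUV : ∀ {a b} → Adj G a b → ¬ IsUV a b
  AdjG⇒¬IsUV (inj₁ ab∈) = proj₂ (∈G⇒∈E×¬IsUV ab∈)
  AdjG⇒¬IsUV (inj₂ ba∈) = proj₂ (∈G⇒∈E×¬IsUV ba∈) ∘ IsUV-sym

  AdjE⇒AdjG : ∀ {a b} → Adj E a b → ¬ IsUV a b → Adj G a b
  AdjE⇒AdjG (inj₁ ab∈) ¬uv = inj₁ (∈E×¬IsUV⇒∈G ab∈ ¬uv)
  AdjE⇒AdjG (inj₂ ba∈) ¬uv = inj₂ (∈E×¬IsUV⇒∈G ba∈ (¬uv ∘ IsUV-sym))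

  G-loopless : Loopless G
  G-loopless a b = loopless a b ∘ proj₁ ∘ ∈G⇒∈E×¬IsUV

  G-injective : InjRank G π
  G-injective a b c d ab∈ cd∈ =
    injective a b c d (proj₁ (∈G⇒∈E×¬IsUV ab∈)) (proj₁ (∈G⇒∈E×¬IsUV cd∈))

  maxRank : ℕ
  maxRank = max 0 (List.map (rk π) E)

  ranks≤maxRank : All (λ e → rk π e ≤ maxRank) E
  ranks≤maxRank = All.map⁻ (xs≤max 0 (List.map (rk π) E))

  rank≤maxRank : ∀ {a b} → Adj G a b → π a b ≤ maxRank
  rank≤maxRank adj with AdjG⇒AdjE adj
  ... | inj₁ ab∈ = All.lookup ranks≤maxRank ab∈
  ... | inj₂ ba∈ = subst (_≤ maxRank) (π-sym _ _) (All.lookup ranks≤maxRank ba∈)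

  Pending : List (Fin n × ℕ) → Fin n → ℕ → Set
  Pending S a ρ = ∃ λ r → (a , r) ∈ S × r < ρ

  -- The loop invariant: an edge that is not dominated still has an endpoint queued below its
  -- rank, whose later scan will examine it.
  Settled : State → Fin n → Fin n → Set
  Settled st a b = Dominated (k st) a b ⊎ (Pending (S st) a (π a b) ⊎ Pending (S st) b (π a b))

  Settled-sym : ∀ {st a b} → Settled st b a → Settled st a b
  Settled-sym (inj₁ dom) = inj₁ (Dominated-sym dom)
  Settled-sym {st} {a} {b} (inj₂ pend) =
    inj₂ (Sum.swap (subst (λ ρ → Pending (S st) b ρ ⊎ Pending (S st) a ρ) (π-sym b a) pend))

  record Invariant (st : State) : Set where
    field
      matching : Matching G (P st) (k st)
      settled : ∀ {a b} → Adj G a b → Settled st a b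

  clear : {A : Set} → (Fin n → Maybe A) → Maybe (Fin n) → Fin n → Maybe A
  clear f nothing = f
  clear f (just x) = upd f x nothing

  clear-other : ∀ {A : Set} (f : Fin n → Maybe A) {m z} → m ≢ just z → clear f m z ≡ f z
  clear-other f {nothing} _ = refl
  clear-other f {just x} m≢z = upd-other f nothing (m≢z ∘ cong just ∘ sym)

  clear-partner : ∀ {A : Set} (f : Fin n → Maybe A) z → clear f (just z) z ≡ nothing
  clear-partner f z = upd-same f z nothing

  evictions : Fin n → Maybe (Fin n) → List (Fin n × ℕ)
  evictions y nothing = []
  evictions y (just x) = (x , π y x) ∷ []

  evict≡ : ∀ st y → k st y ≡ Maybe.map (π y) (P st y) →
           evict st y ≡ ⟨ clear (P st) (P st y) , clear (k st) (P st y) , evictions y (P st y) ++ S st ⟩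
  evict≡ st y ky with k st y | P st y
  evict≡ st y refl | just _ | just x = refl
  evict≡ st y refl | nothing | nothing = refl

  ≮∞⇒≤ : ∀ {r m} → ¬ (_<∞_ {n} r m) → Any (_≤ r) m
  ≮∞⇒≤ {m = just s} r≮s = just (≮⇒≥ r≮s)
  ≮∞⇒≤ {m = nothing} r≮∞ = contradiction _ r≮∞

  <∞-just : ∀ {r m s} → m ≡ just s → _<∞_ {n} r m → r < s
  <∞-just refl r<s = r<s

  ≤-just : ∀ {r m s} → m ≡ just s → Any (_≤ r) m → s ≤ r
  ≤-just refl (just s≤r) = s≤r

  _<∞?_ : ∀ r m → Dec (_<∞_ {n} r m)
  r <∞? just s = r <? s
  r <∞? nothing = yes _

  ¬Cand⇒Dominated : ∀ {st a r b} → Adj G a b → r < π a b → ¬ Cand G π st a r b → Dominated (k st) a b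
  ¬Cand⇒Dominated {st} {a} {r} {b} adj r<ρ ¬cand with π a b <∞? k st a | π a b <∞? k st b
  ... | yes ρ<ka | yes ρ<kb = contradiction (adj , r<ρ , ρ<ka , ρ<kb) ¬cand
  ... | no ρ≮ka | _ = inj₁ (≮∞⇒≤ ρ≮ka)
  ... | yes _ | no ρ≮kb = inj₂ (≮∞⇒≤ ρ≮kb)

  no-partner-invariant : ∀ {st v' r} (p : (v' , r) ∈ S st) → (∀ w → ¬ Cand G π st v' r w) →
                         Invariant st → Invariant ⟨ P st , k st , S st ─ p ⟩
  no-partner-invariant {st} {v'} {r} p no-cand inv = record { matching = matching ; settled = settled′ }
    where
    open Invariant inv
    st' = ⟨ P st , k st , S st ─ p ⟩
    pending : ∀ {a b r'} → Adj G a b → (a , r') ∈ S st → r' < π a b → Settled st' a b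
    pending adj a∈ r'<ρ with ∈⇒≡⊎∈-─ p a∈
    ... | inj₁ refl = inj₁ (¬Cand⇒Dominated {st} adj r'<ρ (no-cand _))
    ... | inj₂ a∈′ = inj₂ (inj₁ (_ , a∈′ , r'<ρ))
    settled′ : ∀ {a b} → Adj G a b → Settled st' a b
    settled′ adj with settled adj
    ... | inj₁ dom = inj₁ dom
    ... | inj₂ (inj₁ (_ , a∈ , r<ρ)) = pending adj a∈ r<ρ
    ... | inj₂ (inj₂ (_ , b∈ , r<ρ)) = Settled-sym {st'} (pending (Adj-sym adj) b∈ (subst (_ <_) (π-sym _ _) r<ρ))

  clear-nothing : ∀ {A : Set} (f : Fin n → Maybe A) {z} m → f z ≡ nothing → clear f m z ≡ nothing
  clear-nothing f nothing fz = fz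
  clear-nothing f {z} (just x) fz with z ≟ x
  ... | yes _ = refl
  ... | no _ = fz

  evictions-∈ : ∀ {st y z} → P st y ≡ just z → (z , π y z) ∈ evictions y (P st y)
  evictions-∈ Pyz rewrite Pyz = here refl

  length-evictions : ∀ y m → length (evictions y m) ≤ 1
  length-evictions y nothing = z≤n
  length-evictions y (just x) = ≤-refl

  module NewPartner {st v' r w} (p : (v' , r) ∈ S st) (inv : Invariant st) (first : First G π st v' r w) where
    open Invariant inv
    open Matching matching

    ρ : ℕ
    ρ = π v' w

    v'w-adj : Adj G v' w
    v'w-adj = proj₁ (proj₁ first)

    r<ρ : r < ρ
    r<ρ = proj₁ (proj₂ (proj₁ first))

    ρ<k : ∀ {c} → c ≡ v' ⊎ c ≡ w → _<∞_ {n} ρ (k st c)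
    ρ<k (inj₁ refl) = proj₁ (proj₂ (proj₂ (proj₁ first)))
    ρ<k (inj₂ refl) = proj₂ (proj₂ (proj₂ (proj₁ first)))

    v'≢w : v' ≢ w
    v'≢w = Adj-irrefl G-loopless v'w-adj

    Pw≢v' : P st w ≢ just v'
    Pw≢v' Pw = <-irrefl (π-sym v' w) (<∞-just (rank-matched Pw) (ρ<k (inj₂ refl)))

    after : ∀ {A : Set} → (Fin n → Maybe A) → Fin n → Maybe A
    after f = clear (clear f (P st w)) (P st v')

    st₁ st₂ st' : State
    st₁ = ⟨ P st , k st , S st ─ p ⟩
    st₂ = ⟨ clear (P st) (P st w) , clear (k st) (P st w) , evictions w (P st w) ++ (S st ─ p) ⟩
    st' = matchUp π (evict (evict st₁ w) v') v' w

    evicted-twice : evict (evict st₁ w) v' ≡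
                    ⟨ after (P st) , after (k st) , evictions v' (P st v') ++ evictions w (P st w) ++ (S st ─ p) ⟩
    evicted-twice = begin
      evict (evict st₁ w) v'
        ≡⟨ cong (λ s → evict s v') (evict≡ st₁ w (rank w)) ⟩
      evict st₂ v'
        ≡⟨ evict≡ st₂ v' k₂v' ⟩
      ⟨ clear (P st₂) (P st₂ v') , clear (k st₂) (P st₂ v') , evictions v' (P st₂ v') ++ S st₂ ⟩
        ≡⟨ cong (λ m → ⟨ clear (P st₂) m , clear (k st₂) m , evictions v' m ++ S st₂ ⟩) Pv'-kept ⟩
      ⟨ after (P st) , after (k st) , evictions v' (P st v') ++ S st₂ ⟩ ∎
      where
      open ≡-Reasoning
      Pv'-kept : clear (P st) (P st w) v' ≡ P st v'
      Pv'-kept = clear-other (P st) Pw≢v'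
      k₂v' : clear (k st) (P st w) v' ≡ Maybe.map (π v') (clear (P st) (P st w) v')
      k₂v' = trans (clear-other (k st) Pw≢v') (trans (rank v') (cong (Maybe.map (π v')) (sym Pv'-kept)))

    P₃ : Fin n → Maybe (Fin n)
    P₃ = P (evict (evict st₁ w) v')

    k₃ : Fin n → Maybe ℕ
    k₃ = k (evict (evict st₁ w) v')

    P'v' : P st' v' ≡ just w
    P'v' = trans (upd-other (upd P₃ v' (just w)) (just v') v'≢w) (upd-same P₃ v' (just w))

    P'w : P st' w ≡ just v'
    P'w = upd-same (upd P₃ v' (just w)) w (just v')

    k'c : ∀ {c} → c ≡ v' ⊎ c ≡ w → k st' c ≡ just ρ
    k'c (inj₁ refl) = trans (upd-other (upd k₃ v' (just ρ)) (just ρ) v'≢w) (upd-same k₃ v' (just ρ))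
    k'c (inj₂ refl) = upd-same (upd k₃ v' (just ρ)) w (just ρ)

    P'≡after : ∀ {z} → z ≢ v' → z ≢ w → P st' z ≡ after (P st) z
    P'≡after {z} z≢v' z≢w = begin
      P st' z  ≡⟨ upd-other (upd P₃ v' (just w)) (just v') z≢w ⟩
      upd P₃ v' (just w) z  ≡⟨ upd-other P₃ (just w) z≢v' ⟩
      P₃ z  ≡⟨ cong (λ s → P s z) evicted-twice ⟩
      after (P st) z ∎
      where open ≡-Reasoning

    k'≡after : ∀ {z} → z ≢ v' → z ≢ w → k st' z ≡ after (k st) z
    k'≡after {z} z≢v' z≢w = begin
      k st' z  ≡⟨ upd-other (upd k₃ v' (just ρ)) (just ρ) z≢w ⟩
      upd k₃ v' (just ρ) z  ≡⟨ upd-other k₃ (just ρ) z≢v' ⟩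
      k₃ z  ≡⟨ cong (λ s → k s z) evicted-twice ⟩
      after (k st) z ∎
      where open ≡-Reasoning

    new-entries : List (Fin n × ℕ)
    new-entries = evictions v' (P st v') ++ evictions w (P st w)

    S'≡ : S st' ≡ new-entries ++ (S st ─ p)
    S'≡ = trans (cong S evicted-twice) (sym (++-assoc (evictions v' (P st v')) _ _))

    new-entries-above : All (λ q → ρ < proj₂ q) new-entries
    new-entries-above = All.++⁺ (above (inj₁ refl)) (above (inj₂ refl))
      where
      above : ∀ {c} → c ≡ v' ⊎ c ≡ w → All (λ q → ρ < proj₂ q) (evictions c (P st c))
      above {c} c∈ with P st c in Pc
      ... | nothing = All.[]
      ... | just _ = <∞-just (rank-matched Pc) (ρ<k c∈) All.∷ All.[]

    length-new-entries : length new-entries ≤ 2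
    length-new-entries = begin
      length new-entries
        ≡⟨ length-++ (evictions v' (P st v')) ⟩
      length (evictions v' (P st v')) + length (evictions w (P st w))
        ≤⟨ +-mono-≤ (length-evictions v' (P st v')) (length-evictions w (P st w)) ⟩
      2 ∎
      where open ≤-Reasoning

    survives : ∀ {q} → q ∈ (S st ─ p) → q ∈ S st'
    survives q∈ = subst (_ ∈_) (sym S'≡) (∈-++⁺ʳ new-entries q∈)

    Untouched : Fin n → Set
    Untouched z = (z ≢ v' × z ≢ w) × (P st v' ≢ just z × P st w ≢ just z)

    untouched-kept : ∀ {z} → Untouched z → P st' z ≡ P st z × k st' z ≡ k st z
    untouched-kept ((z≢v' , z≢w) , (Pv'≢z , Pw≢z)) =
      trans (P'≡after z≢v' z≢w) (trans (clear-other _ Pv'≢z) (clear-other (P st) Pw≢z)) ,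
      trans (k'≡after z≢v' z≢w) (trans (clear-other _ Pv'≢z) (clear-other (k st) Pw≢z))

    Untouched-partner : ∀ {x y} → Untouched x → P st x ≡ just y → Untouched y
    Untouched-partner ((x≢v' , x≢w) , (Pv'≢x , Pw≢x)) Pxy =
      ((λ { refl → Pv'≢x (partner-sym Pxy) }) , (λ { refl → Pw≢x (partner-sym Pxy) })) ,
      ((λ Pv'y → x≢v' (just-injective (trans (sym (partner-sym Pxy)) (partner-sym Pv'y)))) ,
       (λ Pwy → x≢w (just-injective (trans (sym (partner-sym Pxy)) (partner-sym Pwy)))))

    after-evicted : ∀ {A : Set} (f : Fin n → Maybe A) {z c} → c ≡ v' ⊎ c ≡ w → P st c ≡ just z →
                    after f z ≡ nothing
    after-evicted f {z} (inj₁ refl) Pv'z =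
      trans (cong (λ m → clear (clear f (P st w)) m z) Pv'z) (clear-partner (clear f (P st w)) z)
    after-evicted f {z} (inj₂ refl) Pwz =
      clear-nothing _ (P st v') (trans (cong (λ m → clear f m z) Pwz) (clear-partner f z))

    evicted-cleared : ∀ {z c} → z ≢ v' → z ≢ w → c ≡ v' ⊎ c ≡ w → P st c ≡ just z →
                      P st' z ≡ nothing × k st' z ≡ nothing
    evicted-cleared z≢v' z≢w c∈ Pcz =
      trans (P'≡after z≢v' z≢w) (after-evicted (P st) c∈ Pcz) ,
      trans (k'≡after z≢v' z≢w) (after-evicted (k st) c∈ Pcz)

    evicted-queued : ∀ {z c} → c ≡ v' ⊎ c ≡ w → P st c ≡ just z → (z , π c z) ∈ S st'
    evicted-queued (inj₁ refl) Pv'z = subst (_ ∈_) (sym S'≡) (∈-++⁺ˡ (∈-++⁺ˡ (evictions-∈ {st} Pv'z)))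
    evicted-queued (inj₂ refl) Pwz =
      subst (_ ∈_) (sym S'≡) (∈-++⁺ˡ (∈-++⁺ʳ (evictions v' (P st v')) (evictions-∈ {st} Pwz)))

    data Fate (z : Fin n) : Set where
      is-v' : z ≡ v' → Fate z
      is-w : z ≡ w → Fate z
      evicted : ∀ {c} → z ≢ v' → z ≢ w → c ≡ v' ⊎ c ≡ w → P st c ≡ just z → Fate z
      untouched : Untouched z → Fate z

    fate : ∀ z → Fate z
    fate z with z ≟ v' | z ≟ w | Maybe.≡-dec _≟_ (P st v') (just z) | Maybe.≡-dec _≟_ (P st w) (just z)
    ... | yes z≡v' | _ | _ | _ = is-v' z≡v'
    ... | no _ | yes z≡w | _ | _ = is-w z≡w
    ... | no z≢v' | no z≢w | yes Pv'z | _ = evicted z≢v' z≢w (inj₁ refl) Pv'z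
    ... | no z≢v' | no z≢w | no _ | yes Pwz = evicted z≢v' z≢w (inj₂ refl) Pwz
    ... | no z≢v' | no z≢w | no Pv'≢z | no Pw≢z = untouched ((z≢v' , z≢w) , (Pv'≢z , Pw≢z))

    matching′ : Matching G (P st') (k st')
    matching′ = record { partner-sym = sym′ ; partner-adj = adj′ ; rank = rank′ }
      where
      sym′ : ∀ {x y} → P st' x ≡ just y → P st' y ≡ just x
      sym′ {x} P'x with fate x
      ... | is-v' refl = subst (λ t → P st' t ≡ just v') (just-injective (trans (sym P'v') P'x)) P'w
      ... | is-w refl = subst (λ t → P st' t ≡ just w) (just-injective (trans (sym P'w) P'x)) P'v'
      ... | evicted x≢v' x≢w c∈ Pcx with () ← trans (sym (proj₁ (evicted-cleared x≢v' x≢w c∈ Pcx))) P'x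
      ... | untouched ut =
        let Pxy = trans (sym (proj₁ (untouched-kept ut))) P'x
        in trans (proj₁ (untouched-kept (Untouched-partner ut Pxy))) (partner-sym Pxy)
      adj′ : ∀ {x y} → P st' x ≡ just y → Adj G x y
      adj′ {x} P'x with fate x
      ... | is-v' refl = subst (Adj G v') (just-injective (trans (sym P'v') P'x)) v'w-adj
      ... | is-w refl = subst (Adj G w) (just-injective (trans (sym P'w) P'x)) (Adj-sym v'w-adj)
      ... | evicted x≢v' x≢w c∈ Pcx with () ← trans (sym (proj₁ (evicted-cleared x≢v' x≢w c∈ Pcx))) P'x
      ... | untouched ut = partner-adj (trans (sym (proj₁ (untouched-kept ut))) P'x)
      rank′ : ∀ x → k st' x ≡ Maybe.map (π x) (P st' x)
      rank′ x with fate x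
      ... | is-v' refl = trans (k'c (inj₁ refl)) (cong (Maybe.map (π v')) (sym P'v'))
      ... | is-w refl = trans (k'c (inj₂ refl)) (trans (cong just (π-sym v' w)) (cong (Maybe.map (π w)) (sym P'w)))
      ... | evicted x≢v' x≢w c∈ Pcx =
        let (P'x , k'x) = evicted-cleared x≢v' x≢w c∈ Pcx in trans k'x (cong (Maybe.map (π x)) (sym P'x))
      ... | untouched ut =
        let (P'x , k'x) = untouched-kept ut in trans k'x (trans (rank x) (cong (Maybe.map (π x)) (sym P'x)))

    improved : ∀ {c b} → c ≡ v' ⊎ c ≡ w → Any (_≤ π c b) (k st c) → Any (_≤ π c b) (k st' c)
    improved {c} c∈ kc≤ with k st c | ρ<k c∈ | kc≤
    ... | just _ | ρ<s | just s≤ = subst (Any _) (sym (k'c c∈)) (just (<⇒≤ (<-≤-trans ρ<s s≤)))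

    -- An evicted endpoint a re-enters the queue with the rank of its old edge ac; if that
    -- was exactly π a b then ac = ab, and now b = c carries the lighter edge v'w.
    dominated-endpoint : ∀ {a b} → Adj G a b → Any (_≤ π a b) (k st a) → Settled st' a b
    dominated-endpoint {a} {b} adj ka≤ with fate a
    ... | is-v' refl = inj₁ (inj₁ (improved (inj₁ refl) ka≤))
    ... | is-w refl = inj₁ (inj₁ (improved (inj₂ refl) ka≤))
    ... | untouched ut = inj₁ (inj₁ (subst (Any _) (sym (proj₂ (untouched-kept ut))) ka≤))
    ... | evicted {c} a≢v' a≢w c∈ Pca
      with m≤n⇒m<n∨m≡n (≤-just (rank-matched (partner-sym Pca)) ka≤)
    ...   | inj₁ πac<πab = inj₂ (inj₁ (π c a , evicted-queued c∈ Pca , subst (_< π a b) (π-sym a c) πac<πab))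
    ...   | inj₂ πac≡πab
      with Adj-rank-injective G-loopless G-injective (partner-adj (partner-sym Pca)) adj πac≡πab
    ...     | inj₂ (a≡b , _) = contradiction a≡b (Adj-irrefl G-loopless adj)
    ...     | inj₁ (_ , refl) = inj₁ (inj₂ (subst (Any _) (sym (k'c c∈)) (just (<⇒≤ ρ<πab))))
      where
      ρ<πab : ρ < π a c
      ρ<πab = subst (ρ <_) (π-sym c a) (<∞-just (rank-matched Pca) (ρ<k c∈))

    pending-endpoint : ∀ {a b r'} → Adj G a b → (a , r') ∈ S st → r' < π a b → Settled st' a b
    pending-endpoint {b = b} adj a∈ r'<πab with ∈⇒≡⊎∈-─ p a∈
    ... | inj₂ a∈′ = inj₂ (inj₁ (_ , survives a∈′ , r'<πab))
    ... | inj₁ refl with ρ ≤? π v' b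
    ...   | yes ρ≤ = inj₁ (inj₁ (subst (Any _) (sym (k'c (inj₁ refl))) (just ρ≤)))
    ...   | no ρ≰ with ¬Cand⇒Dominated {st} adj r'<πab (ρ≰ ∘ proj₂ first b)
    ...     | inj₁ kv'≤ = dominated-endpoint adj kv'≤
    ...     | inj₂ kb≤ =
              Settled-sym {st'} (dominated-endpoint (Adj-sym adj) (subst (λ t → Any (_≤ t) _) (π-sym v' b) kb≤))

    invariant′ : Invariant st'
    invariant′ = record { matching = matching′ ; settled = settled′ }
      where
      settled′ : ∀ {a b} → Adj G a b → Settled st' a b
      settled′ adj with settled adj
      ... | inj₁ (inj₁ ka≤) = dominated-endpoint adj ka≤
      ... | inj₁ (inj₂ kb≤) =
            Settled-sym {st'} (dominated-endpoint (Adj-sym adj) (subst (λ t → Any (_≤ t) _) (π-sym _ _) kb≤))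
      ... | inj₂ (inj₁ (_ , a∈ , r<πab)) = pending-endpoint adj a∈ r<πab
      ... | inj₂ (inj₂ (_ , b∈ , r<πab)) =
            Settled-sym {st'} (pending-endpoint (Adj-sym adj) b∈ (subst (_ <_) (π-sym _ _) r<πab))

  -- Each queue entry of priority r weighs 3^(maxRank - r): a newPartner step trades one entry
  -- for at most two entries of strictly larger priority, and 2 · 3^(m - 1) < 3^m.
  weight : List (Fin n × ℕ) → ℕ
  weight [] = 0
  weight ((_ , r) ∷ S) = 3 ^ (maxRank ∸ r) + weight S

  weight-++ : ∀ xs ys → weight (xs ++ ys) ≡ weight xs + weight ys
  weight-++ [] ys = refl
  weight-++ ((_ , r) ∷ xs) ys =
    trans (cong (3 ^ (maxRank ∸ r) +_) (weight-++ xs ys)) (sym (+-assoc (3 ^ (maxRank ∸ r)) (weight xs) (weight ys)))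

  weight-─ : ∀ {q} S (q∈ : q ∈ S) → weight S ≡ 3 ^ (maxRank ∸ proj₂ q) + weight (S ─ q∈)
  weight-─ (_ ∷ S) (here refl) = refl
  weight-─ {q} ((_ , r) ∷ S) (there q∈) =
    trans (cong (3 ^ (maxRank ∸ r) +_) (weight-─ S q∈))
          (x∙yz≈y∙xz (3 ^ (maxRank ∸ r)) (3 ^ (maxRank ∸ proj₂ q)) (weight (S ─ q∈)))

  weight-≤ : ∀ {t} xs → All (λ q → t ≤ proj₂ q) xs → weight xs ≤ length xs * 3 ^ (maxRank ∸ t)
  weight-≤ [] All.[] = z≤n
  weight-≤ (_ ∷ xs) (t≤ All.∷ above) = +-mono-≤ (^-monoʳ-≤ 3 (∸-monoʳ-≤ maxRank t≤)) (weight-≤ xs above)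

  weight-of-later-entries : ∀ {r} xs → r < maxRank → All (λ q → r < proj₂ q) xs → length xs ≤ 2 →
                            weight xs < 3 ^ (maxRank ∸ r)
  weight-of-later-entries {r} xs r<R above len≤2 = begin-strict
    weight xs                     ≤⟨ weight-≤ xs above ⟩
    length xs * 3 ^ (R ∸ suc r)   ≤⟨ *-monoˡ-≤ (3 ^ (R ∸ suc r)) len≤2 ⟩
    2 * 3 ^ (R ∸ suc r)           <⟨ *-monoˡ-< (3 ^ (R ∸ suc r)) {{m^n≢0 3 (R ∸ suc r)}} (n<1+n 2) ⟩
    3 ^ suc (R ∸ suc r)           ≡⟨ cong (3 ^_) (sym (+-∸-assoc 1 r<R)) ⟩
    3 ^ (R ∸ r)                   ∎
    where
    open ≤-Reasoning
    R = maxRank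

  step-invariant : ∀ {st st'} → Step G π st st' → Invariant st → Invariant st' × weight (S st') < weight (S st)
  step-invariant {st} (noPartner {r = r} p _ no-cand) inv =
    no-partner-invariant p no-cand inv ,
    subst (weight (S st ─ p) <_) (sym (weight-─ (S st) p)) (m<n+m (weight (S st ─ p)) (m^n>0 3 (maxRank ∸ r)))
  step-invariant {st} (newPartner {r = r} p _ first) inv = invariant′ , (begin-strict
    weight (S st')                          ≡⟨ cong weight S'≡ ⟩
    weight (new-entries ++ (S st ─ p))      ≡⟨ weight-++ new-entries (S st ─ p) ⟩
    weight new-entries + weight (S st ─ p)  <⟨ +-monoˡ-< (weight (S st ─ p)) fewer ⟩
    3 ^ (maxRank ∸ r) + weight (S st ─ p)   ≡⟨ sym (weight-─ (S st) p) ⟩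
    weight (S st)                           ∎)
    where
    open NewPartner p inv first
    open ≤-Reasoning
    fewer : weight new-entries < 3 ^ (maxRank ∸ r)
    fewer = weight-of-later-entries new-entries (<-≤-trans r<ρ (rank≤maxRank v'w-adj))
              (All.map (<-trans r<ρ) new-entries-above) length-new-entries

  Cand? : ∀ st a r b → Dec (Cand G π st a r b)
  Cand? st a r b = Adj? ×-dec (r <? π a b ×-dec (π a b <∞? k st a ×-dec π a b <∞? k st b))
    where
    open import Data.List.Membership.DecPropositional (Product.≡-dec _≟_ _≟_) using (_∈?_)
    Adj? : Dec (Adj G a b)
    Adj? = ((a , b) ∈? G) ⊎-dec ((b , a) ∈? G)

  progress : ∀ st → ∃ (_∈ S st) → ∃ (Step G π st)
  progress st (q , q∈) with min-satisfying (λ _ → yes tt) proj₂ (S st)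
  ... | inj₁ none = contradiction tt (none q∈)
  ... | inj₂ ((v' , r) , p , _ , lowest) with min-satisfying (Cand? st v' r) (π v') (allFin n)
  ...   | inj₁ none = _ , noPartner p (All.tabulate (λ y∈ → lowest y∈ tt)) (λ w → none (∈-allFin w))
  ...   | inj₂ (w , _ , cand , first) =
          _ , newPartner p (All.tabulate (λ y∈ → lowest y∈ tt)) (cand , λ w' → first (∈-allFin w'))

  empty-or-∈ : ∀ {A : Set} (xs : List A) → xs ≡ [] ⊎ ∃ (_∈ xs)
  empty-or-∈ [] = inj₁ refl
  empty-or-∈ (x ∷ _) = inj₂ (x , here refl)

  accessible : ∀ bound st → Invariant st → weight (S st) < bound → Acc (flip (Step G π)) st
  accessible (suc bound) st inv w< = acc λ step →
    let (inv′ , decrease) = step-invariant step inv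
    in accessible bound _ inv′ (<-≤-trans decrease (≤-pred w<))

  terminates : ∀ bound st → Invariant st → weight (S st) < bound →
               ∃ λ st' → Star (Step G π) st st' × S st' ≡ []
  terminates (suc bound) st inv w< with empty-or-∈ (S st)
  ... | inj₁ S≡[] = st , ε , S≡[]
  ... | inj₂ nonempty =
    let (st′ , step) = progress st nonempty
        (inv′ , decrease) = step-invariant step inv
        (st″ , steps , done) = terminates bound st′ inv′ (<-≤-trans decrease (≤-pred w<))
    in st″ , step ◅ steps , done

  invariant-star : ∀ {st st'} → Star (Step G π) st st' → Invariant st → Invariant st'
  invariant-star ε inv = inv
  invariant-star (step ◅ steps) inv = invariant-star steps (proj₁ (step-invariant step inv))

  finished-represents : ∀ st → Invariant st → S st ≡ [] → Represents G π (P st) (k st)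
  finished-represents st inv S≡[] = matching⇒represents G-loopless G-injective matching dominating
    where
    open Invariant inv
    dominating : Dominating G (k st)
    dominating adj with settled adj
    ... | inj₁ dom = dom
    ... | inj₂ (inj₁ (_ , a∈ , _)) with () ← subst (_ ∈_) S≡[] a∈
    ... | inj₂ (inj₂ (_ , b∈ , _)) with () ← subst (_ ∈_) S≡[] b∈

  IsUV-rank : ∀ {a b} → IsUV a b → π a b ≡ π u v
  IsUV-rank (inj₁ (refl , refl)) = refl
  IsUV-rank (inj₂ (refl , refl)) = π-sym v u

  module _ {P₀ : Fin n → Maybe (Fin n)} {k₀ : Fin n → Maybe ℕ} (rep : Represents E π P₀ k₀) where
    private
      M₀ = represents⇒matching loopless rep
      open Matching M₀

    unmatched-uv-invariant : P₀ v ≢ just u → Invariant ⟨ P₀ , k₀ , [] ⟩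
    unmatched-uv-invariant Pv≢u = record
      { matching = record { partner-sym = partner-sym ; partner-adj = adj′ ; rank = rank }
      ; settled = inj₁ ∘ represents⇒dominating loopless rep ∘ AdjG⇒AdjE }
      where
      adj′ : ∀ {x y} → P₀ x ≡ just y → Adj G x y
      adj′ Pxy = AdjE⇒AdjG (partner-adj Pxy) λ
        { (inj₁ (refl , refl)) → Pv≢u (partner-sym Pxy)
        ; (inj₂ (refl , refl)) → Pv≢u Pxy }

    detach : ∀ {A : Set} → (Fin n → Maybe A) → Fin n → Maybe A
    detach f = upd (upd f u nothing) v nothing

    detach-uv : ∀ {A : Set} (f : Fin n → Maybe A) {z} → z ≡ u ⊎ z ≡ v → detach f z ≡ nothing
    detach-uv f {z} z∈uv with z ≟ v
    ... | yes _ = refl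
    detach-uv f (inj₁ refl) | no _ = upd-same f u nothing
    detach-uv f (inj₂ refl) | no v≢v = contradiction refl v≢v

    detach-other : ∀ {A : Set} (f : Fin n → Maybe A) {z} → z ≢ u → z ≢ v → detach f z ≡ f z
    detach-other f z≢u z≢v = trans (upd-other (upd f u nothing) nothing z≢v) (upd-other f nothing z≢u)

    module _ (Pvu : P₀ v ≡ just u) where

      detached : State
      detached = ⟨ detach P₀ , detach k₀ , (u , π u v) ∷ (v , π u v) ∷ [] ⟩

      detached-matching : Matching G (detach P₀) (detach k₀)
      detached-matching = record { partner-sym = sym′ ; partner-adj = adj′ ; rank = rank′ }
        where
        Puv : P₀ u ≡ just v
        Puv = partner-sym Pvu
        off-uv : ∀ x → (x ≡ u ⊎ x ≡ v) ⊎ (x ≢ u × x ≢ v)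
        off-uv x with x ≟ u | x ≟ v
        ... | yes x≡u | _ = inj₁ (inj₁ x≡u)
        ... | no _ | yes x≡v = inj₁ (inj₂ x≡v)
        ... | no x≢u | no x≢v = inj₂ (x≢u , x≢v)
        sym′ : ∀ {x y} → detach P₀ x ≡ just y → detach P₀ y ≡ just x
        sym′ {x} {y} Pxy with off-uv x
        ... | inj₁ x∈uv with () ← trans (sym (detach-uv P₀ x∈uv)) Pxy
        ... | inj₂ (x≢u , x≢v) = trans (detach-other P₀ y≢u y≢v) Pyx
          where
          Pyx = partner-sym (trans (sym (detach-other P₀ x≢u x≢v)) Pxy)
          y≢u : y ≢ u
          y≢u refl = x≢v (just-injective (trans (sym Pyx) Puv))
          y≢v : y ≢ v
          y≢v refl = x≢u (just-injective (trans (sym Pyx) Pvu))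
        adj′ : ∀ {x y} → detach P₀ x ≡ just y → Adj G x y
        adj′ {x} Pxy with off-uv x
        ... | inj₁ x∈uv with () ← trans (sym (detach-uv P₀ x∈uv)) Pxy
        ... | inj₂ (x≢u , x≢v) = AdjE⇒AdjG (partner-adj (trans (sym (detach-other P₀ x≢u x≢v)) Pxy))
              λ { (inj₁ (u≡x , _)) → x≢u (sym u≡x) ; (inj₂ (_ , v≡x)) → x≢v (sym v≡x) }
        rank′ : ∀ x → detach k₀ x ≡ Maybe.map (π x) (detach P₀ x)
        rank′ x with off-uv x
        ... | inj₁ x∈uv = trans (detach-uv k₀ x∈uv) (cong (Maybe.map (π x)) (sym (detach-uv P₀ x∈uv)))
        ... | inj₂ (x≢u , x≢v) =
              trans (detach-other k₀ x≢u x≢v)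
                    (trans (rank x) (cong (Maybe.map (π x)) (sym (detach-other P₀ x≢u x≢v))))

      -- u and v re-enter the queue with priority π u v; an edge ub of G with k₀ u = π u v ≤ π u b
      -- is then pending, the ranks being distinct as ub ≠ uv.
      queued-endpoint : ∀ {a a' b} → Adj G a b → Any (_≤ π a b) (k₀ a) → P₀ a ≡ just a' → IsUV a a' →
                        (a , π u v) ∈ S detached → Pending (S detached) a (π a b)
      queued-endpoint {a} {a'} {b} adj ka≤ Paa' aa'-uv a∈
        with m≤n⇒m<n∨m≡n (≤-just (rank-matched Paa') ka≤)
      ... | inj₁ πaa'<πab = π u v , a∈ , subst (_< π a b) (IsUV-rank aa'-uv) πaa'<πab
      ... | inj₂ πaa'≡πab with Adj-rank-injective loopless injective (partner-adj Paa') (AdjG⇒AdjE adj) πaa'≡πab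
      ...   | inj₁ (_ , refl) = contradiction aa'-uv (AdjG⇒¬IsUV adj)
      ...   | inj₂ (a≡b , _) = contradiction a≡b (Adj-irrefl G-loopless adj)

      detached-endpoint : ∀ {a b} → Adj G a b → Any (_≤ π a b) (k₀ a) → Settled detached a b
      detached-endpoint {a} adj ka≤ with a ≟ u | a ≟ v
      ... | yes refl | _ = inj₂ (inj₁ (queued-endpoint adj ka≤ (partner-sym Pvu) (inj₁ (refl , refl)) (here refl)))
      ... | no _ | yes refl = inj₂ (inj₁ (queued-endpoint adj ka≤ Pvu (inj₂ (refl , refl)) (there (here refl))))
      ... | no _ | no _ = inj₁ (inj₁ ka≤)

      detached-invariant : Invariant detached
      detached-invariant = record { matching = detached-matching ; settled = settled′ }
        where
        settled′ : ∀ {a b} → Adj G a b → Settled detached a b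
        settled′ adj with represents⇒dominating loopless rep (AdjG⇒AdjE adj)
        ... | inj₁ ka≤ = detached-endpoint adj ka≤
        ... | inj₂ kb≤ =
              Settled-sym {detached} (detached-endpoint (Adj-sym adj) (subst (λ t → Any (_≤ t) _) (π-sym _ _) kb≤))

    initial-invariant : Invariant (initDelete π u v P₀ k₀)
    initial-invariant with P₀ v in Pv
    ... | nothing = unmatched-uv-invariant λ Pvu → case trans (sym Pv) Pvu of λ ()
    ... | just x with x ≟ u
    ...   | yes refl = detached-invariant Pv
    ...   | no x≢u = unmatched-uv-invariant (x≢u ∘ just-injective ∘ trans (sym Pv))

lemma4p4 : {n : ℕ} (E : List (Edge n)) (π : Rank n) →
    Loopless E → SymRank π → InjRank E π →
    (P₀ : Fin n → Maybe (Fin n)) (k₀ : Fin n → Maybe ℕ) → Represents E π P₀ k₀ →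
    (u v : Fin n) → Adj E u v →
    Acc (flip (Step (deleteEdge E u v) π)) (initDelete π u v P₀ k₀)
    × (∃ λ st → Star (Step (deleteEdge E u v) π) (initDelete π u v P₀ k₀) st × S st ≡ [])
    × (∀ st → Star (Step (deleteEdge E u v) π) (initDelete π u v P₀ k₀) st → S st ≡ [] →
         Represents (deleteEdge E u v) π (P st) (k st))
lemma4p4 E π loopless π-sym injective P₀ k₀ rep u v uv∈E =
  accessible _ st₀ inv₀ (n<1+n _) ,
  terminates _ st₀ inv₀ (n<1+n _) ,
  λ st steps done → finished-represents st (invariant-star steps inv₀) done
  where
  open Deletion E π loopless π-sym injective u v uv∈E
  st₀ = initDelete π u v P₀ k₀
  inv₀ = initial-invariant rep
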